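{- Let $q$ be a prime power and $n,k,t,\lambda$ positive integers with $\lambda > 1$, $k > n/2$, $k \le n$ and $t \le 2k-n$. Then $$\mathcal{A}^r_q(n,k,t;\lambda) \le 1 + \mathcal{A}^r_q(k,2k-n,t;\lambda-1).$$
   Context: A $t$-$(n,k,\lambda)_q$ subspace packing is a collection (possibly a multiset) of $k$-dimensional subspaces (blocks) of $\mathbb{F}_q^n$ such that every $t$-dimensional subspace of $\mathbb{F}_q^n$ is contained in at most $\lambda$ blocks, counted with multiplicity. $\mathcal{A}^r_q(n,k,t;\lambda)$ denotes the maximum number of blocks (counted with multiplicity) in such a packing when repeated blocks are allowed. -}

module Defs where

open import Level using (0ℓ)
open import Algebra.Bundles using (CommutativeRing)
open import Data.Nat using (ℕ; zero; suc)
open import Data.Fin using (Fin; zero; suc)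
open import Data.List using (List; length; lookup)
open import Data.Product using (∃; _×_)
open import Function using (_∘_)
open import Function.Definitions using (Injective)
open import Relation.Nullary using (¬_)
open import Relation.Binary.PropositionalEquality using (_≡_)

record IsFieldOn (R : CommutativeRing 0ℓ 0ℓ) : Set where
  open CommutativeRing R
  field
    0≉1     : ¬ (0# ≈ 1#)
    inverse : ∀ x → ¬ (x ≈ 0#) → ∃ λ y → (x * y) ≈ 1#

record FiniteField (q : ℕ) : Set₁ where
  field
    ring      : CommutativeRing 0ℓ 0ℓ
    isField   : IsFieldOn ring
  open CommutativeRing ring using (Carrier; _≈_; _+_; _*_; 0#; 1#)
  field
    enum      : Fin q → Carrier
    enum-surj : ∀ x → ∃ λ i → enum i ≈ x
    enum-inj  : ∀ i j → enum i ≈ enum j → i ≡ j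

module Linear {q : ℕ} (F : FiniteField q) where
  open FiniteField F
  open CommutativeRing ring using (Carrier; _≈_; _+_; _*_; 0#; 1#)

  Vector : ℕ → Set
  Vector n = Fin n → Carrier

  lincomb : ∀ {m n} → (Fin m → Carrier) → (Fin m → Vector n) → Vector n
  lincomb {zero}  c b j = 0#
  lincomb {suc m} c b j = (c zero * b zero j) + lincomb (c ∘ suc) (b ∘ suc) j

  LinIndep : ∀ {m n} → (Fin m → Vector n) → Set
  LinIndep b = ∀ c → (∀ j → lincomb c b j ≈ 0#) → ∀ i → c i ≈ 0#

  InSpan : ∀ {m n} → Vector n → (Fin m → Vector n) → Set
  InSpan v b = ∃ λ c → ∀ j → v j ≈ lincomb c b j

  -- A k-dimensional subspace of F_q^n, given by (any) basis; it is the span of the basis.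
  record Subspace (n k : ℕ) : Set where
    field
      basis : Fin k → Vector n
      indep : LinIndep basis
  open Subspace public

  _⊆ₛ_ : ∀ {n t k} → Subspace n t → Subspace n k → Set
  T ⊆ₛ B = ∀ i → InSpan (basis T i) (basis B)

  -- A t-(n,k,λ)_q subspace packing with repeated blocks allowed: a list (multiset) of
  -- k-subspaces such that no t-subspace is contained in lam+1 blocks at distinct positions.
  IsPacking : (n k t lam : ℕ) → List (Subspace n k) → Set
  IsPacking n k t lam P =
    ∀ (T : Subspace n t) (f : Fin (suc lam) → Fin (length P)) →
      Injective _≡_ _≡_ f → ¬ (∀ j → T ⊆ₛ lookup P (f j))

module Submission where

-- Take a packing P = B₀ ∷ rest and fix the first block B₀ ≅ Fᵏ (via its basis).
-- Every other block B meets B₀ in dimension ≥ 2k − n; reading a (2k − n)-dimensional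
-- part of B₀ ∩ B in the coordinates of B₀ gives a (2k − n)-subspace of Fᵏ, the
-- "residual" of B. If a t-subspace T of Fᵏ lay in λ residual blocks, its image in B₀
-- would lie in those λ blocks of P and in B₀ itself, i.e. in λ + 1 blocks of P; so
-- the residuals form a packing with multiplicity λ − 1 and |P| = 1 + |residuals|.

open import Defs
open import Algebra.Bundles using (CommutativeRing)
open import Data.Nat using (ℕ; zero; suc)
import Data.Nat as ℕ
import Data.Nat.Properties as ℕₚ
open import Data.Fin using (Fin; zero; suc; punchIn; _↑ˡ_; _↑ʳ_; splitAt)
open import Data.Fin.Properties using (any?; splitAt⁻¹-↑ˡ; splitAt⁻¹-↑ʳ)
import Data.Fin.Properties as Fin
open import Data.Vec.Functional using (_++_; insertAt) renaming (_∷_ to _∷ᵥ_)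
open import Data.Vec.Functional.Properties using (insertAt-lookup; insertAt-punchIn; lookup-++ˡ; lookup-++ʳ)
open import Data.Product using (Σ; ∃; _×_; _,_; proj₁; proj₂)
open import Data.Sum using (_⊎_; inj₁; inj₂)
open import Function using (_∘_)
open import Relation.Nullary using (¬_; Dec; yes; no; ¬?)
open import Relation.Nullary.Decidable using (decidable-stable)
open import Relation.Binary.PropositionalEquality as ≡ using (_≡_)

module LinearAlgebra {q : ℕ} (F : FiniteField q) where
  open FiniteField F renaming (ring to R)
  open CommutativeRing R hiding (ring; zero)
  open Linear F
  open import Algebra.Properties.Ring (CommutativeRing.ring R)
    using (-0#≈0#; +-inverseˡ-unique; -‿+-comm; -‿distribˡ-*; -‿distribʳ-*; x[y-z]≈xy-xz)
  open import Algebra.Properties.Semiring.Sum semiring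
    using (sum; sum-cong-≋; sum-cong-≗; sum-remove; ∑-comm; ∑-distrib-+; *-distribˡ-sum; *-distribʳ-sum)
  open import Relation.Binary.Reasoning.Setoid setoid

  _≈?_ : ∀ x y → Dec (x ≈ y)
  x ≈? y with enum-surj x | enum-surj y
  ... | i , eᵢ≈x | j , eⱼ≈y with i Fin.≟ j
  ...   | yes ≡.refl = yes (trans (sym eᵢ≈x) eⱼ≈y)
  ...   | no i≢j = no λ x≈y → i≢j (enum-inj i j (trans eᵢ≈x (trans x≈y (sym eⱼ≈y))))

  nonzero-or-zero : ∀ {N} (f : Fin N → Carrier) → (∃ λ p → ¬ (f p ≈ 0#)) ⊎ (∀ p → f p ≈ 0#)
  nonzero-or-zero f with any? (λ p → ¬? (f p ≈? 0#))
  ... | yes nonzero = inj₁ nonzero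
  ... | no none = inj₂ λ p → decidable-stable (f p ≈? 0#) (λ fp≉0 → none (p , fp≉0))

  sum-zero : ∀ {m} {f : Fin m → Carrier} → (∀ i → f i ≈ 0#) → sum f ≈ 0#
  sum-zero {zero} f≈0 = refl
  sum-zero {suc m} f≈0 = trans (+-cong (f≈0 zero) (sum-zero (f≈0 ∘ suc))) (+-identityˡ 0#)

  sum-negate : ∀ {m} (f : Fin m → Carrier) → sum (λ i → - f i) ≈ - sum f
  sum-negate {zero} f = sym -0#≈0#
  sum-negate {suc m} f = trans (+-congˡ (sum-negate (f ∘ suc))) (-‿+-comm (f zero) (sum (f ∘ suc)))

  vanish-on-halves : ∀ a b (f : Fin (a ℕ.+ b) → Carrier) →
    (∀ i → f (i ↑ˡ b) ≈ 0#) → (∀ i → f (a ↑ʳ i) ≈ 0#) → ∀ j → f j ≈ 0#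
  vanish-on-halves a b f left right j with splitAt a j in split
  ... | inj₁ i = trans (reflexive (≡.cong f (≡.sym (splitAt⁻¹-↑ˡ split)))) (left i)
  ... | inj₂ i = trans (reflexive (≡.cong f (≡.sym (splitAt⁻¹-↑ʳ split)))) (right i)

  lincomb≈sum : ∀ {m n} (c : Fin m → Carrier) (b : Fin m → Vector n) j →
    lincomb c b j ≈ sum (λ i → c i * b i j)
  lincomb≈sum {zero} c b j = refl
  lincomb≈sum {suc m} c b j = +-congˡ (lincomb≈sum (c ∘ suc) (b ∘ suc) j)

  lincomb-cong : ∀ {m n} {c c′ : Fin m → Carrier} {b b′ : Fin m → Vector n} {j} →
    (∀ i → c i ≈ c′ i) → (∀ i → b i j ≈ b′ i j) → lincomb c b j ≈ lincomb c′ b′ j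
  lincomb-cong {zero} c≈c′ b≈b′ = refl
  lincomb-cong {suc m} c≈c′ b≈b′ =
    +-cong (*-cong (c≈c′ zero) (b≈b′ zero)) (lincomb-cong (c≈c′ ∘ suc) (b≈b′ ∘ suc))

  lincomb-reindex : ∀ {m n n′} (c : Fin m → Carrier) (b : Fin m → Vector n) (g : Fin n′ → Fin n) j →
    lincomb c b (g j) ≡ lincomb c (λ l → b l ∘ g) j
  lincomb-reindex {zero} c b g j = ≡.refl
  lincomb-reindex {suc m} c b g j = ≡.cong (c zero * b zero (g j) +_) (lincomb-reindex (c ∘ suc) (b ∘ suc) g j)

  lincomb-zeroᶜ : ∀ {m n} {c : Fin m → Carrier} (b : Fin m → Vector n) j →
    (∀ i → c i ≈ 0#) → lincomb c b j ≈ 0#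
  lincomb-zeroᶜ b j c≈0 = trans (lincomb≈sum _ b j) (sum-zero (λ i → trans (*-congʳ (c≈0 i)) (zeroˡ _)))

  lincomb-zeroᵇ : ∀ {m n} (c : Fin m → Carrier) {b : Fin m → Vector n} j →
    (∀ i → b i j ≈ 0#) → lincomb c b j ≈ 0#
  lincomb-zeroᵇ c {b} j b≈0 = trans (lincomb≈sum c b j) (sum-zero (λ i → trans (*-congˡ (b≈0 i)) (zeroʳ _)))

  lincomb-negateᵇ : ∀ {m n} (c : Fin m → Carrier) (b : Fin m → Vector n) j →
    lincomb c (λ i j′ → - b i j′) j ≈ - lincomb c b j
  lincomb-negateᵇ c b j = begin
    lincomb c (λ i j′ → - b i j′) j ≈⟨ lincomb≈sum c _ j ⟩
    sum (λ i → c i * - b i j)       ≈⟨ sum-cong-≋ (λ i → sym (-‿distribʳ-* (c i) (b i j))) ⟩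
    sum (λ i → - (c i * b i j))     ≈⟨ sum-negate (λ i → c i * b i j) ⟩
    - sum (λ i → c i * b i j)       ≈⟨ -‿cong (lincomb≈sum c b j) ⟨
    - lincomb c b j                 ∎

  lincomb-negateᶜ : ∀ {m n} (c : Fin m → Carrier) (b : Fin m → Vector n) j →
    lincomb (λ i → - c i) b j ≈ - lincomb c b j
  lincomb-negateᶜ c b j = begin
    lincomb (λ i → - c i) b j ≈⟨ lincomb≈sum _ b j ⟩
    sum (λ i → - c i * b i j)   ≈⟨ sum-cong-≋ (λ i → sym (-‿distribˡ-* (c i) (b i j))) ⟩
    sum (λ i → - (c i * b i j)) ≈⟨ sum-negate (λ i → c i * b i j) ⟩
    - sum (λ i → c i * b i j)   ≈⟨ -‿cong (lincomb≈sum c b j) ⟨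
    - lincomb c b j             ∎

  lincomb-compose : ∀ {a k n} (e : Fin a → Carrier) (c : Fin a → Vector k) (b : Fin k → Vector n) j →
    lincomb (lincomb e c) b j ≈ lincomb e (λ l → lincomb (c l) b) j
  lincomb-compose e c b j = begin
    lincomb (lincomb e c) b j                     ≈⟨ lincomb≈sum _ b j ⟩
    sum (λ i → lincomb e c i * b i j)             ≈⟨ sum-cong-≋ (λ i → *-congʳ (lincomb≈sum e c i)) ⟩
    sum (λ i → sum (λ l → e l * c l i) * b i j)   ≈⟨ sum-cong-≋ (λ i → *-distribʳ-sum (b i j) (λ l → e l * c l i)) ⟩
    sum (λ i → sum (λ l → e l * c l i * b i j))   ≈⟨ ∑-comm (λ i l → e l * c l i * b i j) ⟩
    sum (λ l → sum (λ i → e l * c l i * b i j))   ≈⟨ sum-cong-≋ (λ l → sum-cong-≋ (λ i → *-assoc (e l) (c l i) (b i j))) ⟩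
    sum (λ l → sum (λ i → e l * (c l i * b i j))) ≈⟨ sum-cong-≋ (λ l → *-distribˡ-sum (e l) (λ i → c l i * b i j)) ⟨
    sum (λ l → e l * sum (λ i → c l i * b i j))   ≈⟨ sum-cong-≋ (λ l → *-congˡ (lincomb≈sum (c l) b j)) ⟨
    sum (λ l → e l * lincomb (c l) b j)           ≈⟨ lincomb≈sum e _ j ⟨
    lincomb e (λ l → lincomb (c l) b) j           ∎

  lincomb-split : ∀ a {b n} (c : Fin (a ℕ.+ b) → Carrier) (v : Fin (a ℕ.+ b) → Vector n) j →
    lincomb c v j ≈ lincomb (c ∘ (_↑ˡ b)) (v ∘ (_↑ˡ b)) j + lincomb (c ∘ (a ↑ʳ_)) (v ∘ (a ↑ʳ_)) j
  lincomb-split zero c v j = sym (+-identityˡ _)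
  lincomb-split (suc a) c v j =
    trans (+-congˡ (lincomb-split a (c ∘ suc) (v ∘ suc) j)) (sym (+-assoc _ _ _))

  -- The kernel lemma.  A system of n homogeneous linear equations in N unknowns is given
  -- by the coefficient vectors u : Fin N → Fⁿ of the unknowns; x solves it iff ∑ᵢ xᵢ uᵢ = 0.
  record Kernel {N n : ℕ} (m : ℕ) (u : Fin N → Vector n) : Set where
    field
      solutions   : Fin m → Vector N
      independent : LinIndep solutions
      solves      : ∀ l j → lincomb (solutions l) u j ≈ 0#

  kernel-zeroEquation : ∀ {N n m} (u : Fin (suc N) → Vector (suc n)) → (∀ p → u p zero ≈ 0#) →
    Kernel m (λ i j → u (suc i) (suc j)) → Kernel m u
  kernel-zeroEquation {N} {n} {m} u u·0≈0 K = record { solutions = x ; independent = x-indep ; solves = x-solves }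
    where
    open Kernel K renaming (solutions to y)
    x : Fin m → Vector (suc N)
    x l = 0# ∷ᵥ y l
    x-indep : LinIndep x
    x-indep c c·x≈0 = independent c (λ j → trans (reflexive (≡.sym (lincomb-reindex c x suc j))) (c·x≈0 (suc j)))
    x-solves : ∀ l j → lincomb (x l) u j ≈ 0#
    x-solves l zero = lincomb-zeroᵇ (x l) {u} zero u·0≈0
    x-solves l (suc j) = trans (+-cong (zeroˡ _) (trans (reflexive (lincomb-reindex (y l) (u ∘ suc) suc j)) (solves l j)))
                               (+-identityˡ 0#)

  -- If unknown p occurs in the first equation with coefficient a ≠ 0, solve that equation
  -- for it: xₚ = −a⁻¹ ∑_{i≠p} xᵢ uᵢ₀. Substituting into the other equations leaves a
  -- system in the N unknowns i ≠ p, and solutions of it lift back by inserting xₚ.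
  module Pivot {N n : ℕ} (u : Fin (suc N) → Vector (suc n)) (p : Fin (suc N)) (a≉0 : ¬ (u p zero ≈ 0#)) where
    a : Carrier
    a = u p zero

    a⁻¹ : Carrier
    a⁻¹ = proj₁ (IsFieldOn.inverse isField a a≉0)

    s : Fin N → Carrier
    s i = u (punchIn p i) zero * a⁻¹

    -- sᵢ a = uᵢ₀: subtracting sᵢ times the pivot column clears the first equation
    s*a≈u : ∀ i → s i * a ≈ u (punchIn p i) zero
    s*a≈u i = begin
      u (punchIn p i) zero * a⁻¹ * a   ≈⟨ *-assoc _ _ _ ⟩
      u (punchIn p i) zero * (a⁻¹ * a) ≈⟨ *-congˡ (trans (*-comm a⁻¹ a) (proj₂ (IsFieldOn.inverse isField a a≉0))) ⟩
      u (punchIn p i) zero * 1#        ≈⟨ *-identityʳ _ ⟩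
      u (punchIn p i) zero             ∎

    reduced : Fin N → Vector n
    reduced i j = u (punchIn p i) (suc j) - s i * u p (suc j)

    expand : ∀ (z : Vector N) v j → lincomb (insertAt z p v) u j ≈ v * u p j + sum (λ i → z i * u (punchIn p i) j)
    expand z v j = begin
      lincomb (insertAt z p v) u j                                ≈⟨ lincomb≈sum (insertAt z p v) u j ⟩
      sum (λ i → insertAt z p v i * u i j)                        ≈⟨ sum-remove {i = p} (λ i → insertAt z p v i * u i j) ⟩
      insertAt z p v p * u p j
        + sum (λ i → insertAt z p v (punchIn p i) * u (punchIn p i) j)
          ≈⟨ reflexive (≡.cong₂ _+_ (≡.cong (_* u p j) (insertAt-lookup z p v))
                                    (sum-cong-≗ (λ i → ≡.cong (_* u (punchIn p i) j) (insertAt-punchIn z p v i)))) ⟩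
      v * u p j + sum (λ i → z i * u (punchIn p i) j)             ∎

    lift : ∀ {m} → Kernel m reduced → Kernel m u
    lift {m} K = record { solutions = x ; independent = x-indep ; solves = x-solves }
      where
      open Kernel K renaming (solutions to y)

      xₚ : Fin m → Carrier
      xₚ l = - sum (λ i → y l i * s i)

      x : Fin m → Vector (suc N)
      x l = insertAt (y l) p (xₚ l)

      -- deleting coordinate p of the x's gives back the independent y's
      x-indep : LinIndep x
      x-indep c c·x≈0 = independent c λ i →
        trans (lincomb-cong {b = y} {b′ = λ l → x l ∘ punchIn p} (λ _ → refl)
                            (λ l → reflexive (≡.sym (insertAt-punchIn (y l) p (xₚ l) i))))
              (trans (reflexive (≡.sym (lincomb-reindex c x (punchIn p) i))) (c·x≈0 (punchIn p i)))

      xₚ-scaled : ∀ l w → xₚ l * w ≈ - sum (λ i → y l i * s i * w)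
      xₚ-scaled l w = trans (sym (-‿distribˡ-* _ w)) (-‿cong (*-distribʳ-sum w (λ i → y l i * s i)))

      solves-pivot-equation : ∀ l → xₚ l * a + sum (λ i → y l i * u (punchIn p i) zero) ≈ 0#
      solves-pivot-equation l = begin
        xₚ l * a + sum (λ i → y l i * u (punchIn p i) zero)
          ≈⟨ +-congʳ (xₚ-scaled l a) ⟩
        - sum (λ i → y l i * s i * a) + sum (λ i → y l i * u (punchIn p i) zero)
          ≈⟨ +-congʳ (-‿cong (sum-cong-≋ (λ i → trans (*-assoc (y l i) (s i) a) (*-congˡ (s*a≈u i))))) ⟩
        - sum (λ i → y l i * u (punchIn p i) zero) + sum (λ i → y l i * u (punchIn p i) zero)
          ≈⟨ -‿inverseˡ _ ⟩
        0# ∎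

      solves-other-equation : ∀ l j → xₚ l * u p (suc j) + sum (λ i → y l i * u (punchIn p i) (suc j)) ≈ 0#
      solves-other-equation l j = begin
        xₚ l * w + sum (λ i → y l i * u′ i)
          ≈⟨ +-comm _ _ ⟩
        sum (λ i → y l i * u′ i) + xₚ l * w
          ≈⟨ +-congˡ (trans (xₚ-scaled l w) (sym (sum-negate (λ i → y l i * s i * w)))) ⟩
        sum (λ i → y l i * u′ i) + sum (λ i → - (y l i * s i * w))
          ≈⟨ ∑-distrib-+ (λ i → y l i * u′ i) (λ i → - (y l i * s i * w)) ⟨
        sum (λ i → y l i * u′ i + - (y l i * s i * w))
          ≈⟨ sum-cong-≋ (λ i → trans (+-congˡ (-‿cong (*-assoc (y l i) (s i) w)))
                                     (sym (x[y-z]≈xy-xz (y l i) (u′ i) (s i * w)))) ⟩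
        sum (λ i → y l i * reduced i j)
          ≈⟨ trans (sym (lincomb≈sum (y l) reduced j)) (solves l j) ⟩
        0# ∎
        where
        w : Carrier
        w = u p (suc j)
        u′ : Fin N → Carrier
        u′ i = u (punchIn p i) (suc j)

      x-solves : ∀ l j → lincomb (x l) u j ≈ 0#
      x-solves l zero = trans (expand (y l) (xₚ l) zero) (solves-pivot-equation l)
      x-solves l (suc j) = trans (expand (y l) (xₚ l) (suc j)) (solves-other-equation l j)

  unit : ∀ {m} → Fin m → Vector m
  unit zero    zero    = 1#
  unit zero    (suc _) = 0#
  unit (suc _) zero    = 0#
  unit (suc l) (suc i) = unit l i

  lincomb-unit : ∀ {m} (c : Fin m → Carrier) i → lincomb c unit i ≈ c i
  lincomb-unit {suc m} c zero =
    trans (+-cong (*-identityʳ _) (lincomb-zeroᵇ (c ∘ suc) zero (λ _ → refl))) (+-identityʳ _)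
  lincomb-unit {suc m} c (suc i) =
    trans (+-cong (zeroʳ _) (trans (reflexive (lincomb-reindex (c ∘ suc) (unit ∘ suc) suc i))
                                  (lincomb-unit (c ∘ suc) i)))
          (+-identityˡ _)

  -- n homogeneous equations in N = n + m unknowns have m linearly independent solutions
  -- (Gaussian elimination on the first equation).
  kernel : ∀ n m N → n ℕ.+ m ≡ N → (u : Fin N → Vector n) → Kernel m u
  kernel zero m N ≡.refl u = record
    { solutions   = unit
    ; independent = λ c c·e≈0 i → trans (sym (lincomb-unit c i)) (c·e≈0 i)
    ; solves      = λ l () }
  kernel (suc n) m zero () u
  kernel (suc n) m (suc N) n+m≡N u with nonzero-or-zero (λ p → u p zero)
  ... | inj₁ (p , a≉0) =
    Pivot.lift u p a≉0 (kernel n m N (ℕₚ.suc-injective n+m≡N) (Pivot.reduced u p a≉0))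
  ... | inj₂ u·0≈0 =
    kernel-zeroEquation u u·0≈0 (kernel n m N (ℕₚ.suc-injective n+m≡N) (λ i j → u (suc i) (suc j)))

  inBasis : ∀ {n k} → Subspace n k → Vector k → Vector n
  inBasis B₀ v = lincomb v (basis B₀)

  -- Coordinates w.r.t. B₀ define an injective linear map Fᵏ → B₀ ⊆ Fⁿ, so the image of a
  -- t-subspace of Fᵏ is a t-subspace of Fⁿ, and it lies inside B₀.
  embed : ∀ {n k t} → Subspace n k → Subspace k t → Subspace n t
  embed B₀ T = record
    { basis = λ i → inBasis B₀ (basis T i)
    ; indep = λ c c·T≈0 → indep T c (indep B₀ (lincomb c (basis T))
                λ j → trans (lincomb-compose c (basis T) (basis B₀) j) (c·T≈0 j)) }

  embed-⊆ : ∀ {n k t} (B₀ : Subspace n k) (T : Subspace k t) → embed B₀ T ⊆ₛ B₀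
  embed-⊆ B₀ T i = basis T i , λ j → refl

  -- For k-subspaces B₀, B of Fⁿ with n + m = 2k,
  -- the kernel lemma gives m independent relations  c·B₀ + d·B = 0  (c, d ∈ Fᵏ), i.e.
  -- vectors c·B₀ = −d·B of B₀ ∩ B; their B₀-coordinates c span an m-subspace of Fᵏ
  -- every vector of which has its B₀-image inside B.
  module Residual {n k m : ℕ} (n+m≡2k : n ℕ.+ m ≡ k ℕ.+ k) (B₀ B : Subspace n k) where
    -- the 2k unknowns are the coefficients of both bases
    bases : Fin (k ℕ.+ k) → Vector n
    bases = basis B₀ ++ basis B

    open Kernel (kernel n m (k ℕ.+ k) n+m≡2k bases)

    c d : Fin m → Vector k
    c l i = solutions l (i ↑ˡ k)
    d l i = solutions l (k ↑ʳ i)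

    relation : ∀ l j → inBasis B₀ (c l) j + inBasis B (d l) j ≈ 0#
    relation l j = begin
      inBasis B₀ (c l) j + inBasis B (d l) j
        ≈⟨ +-cong (lincomb-cong (λ _ → refl) (λ i → reflexive (≡.cong (λ v → v j) (≡.sym (lookup-++ˡ (basis B₀) (basis B) i)))))
                  (lincomb-cong (λ _ → refl) (λ i → reflexive (≡.cong (λ v → v j) (≡.sym (lookup-++ʳ (basis B₀) (basis B) i))))) ⟩
      lincomb (c l) (bases ∘ (_↑ˡ k)) j + lincomb (d l) (bases ∘ (k ↑ʳ_)) j
        ≈⟨ lincomb-split k (solutions l) bases j ⟨
      lincomb (solutions l) bases j
        ≈⟨ solves l j ⟩
      0# ∎

    c·B₀≈-d·B : ∀ l j → inBasis B₀ (c l) j ≈ - inBasis B (d l) j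
    c·B₀≈-d·B l j = +-inverseˡ-unique _ _ (relation l j)

    d·B≈-c·B₀ : ∀ l j → inBasis B (d l) j ≈ - inBasis B₀ (c l) j
    d·B≈-c·B₀ l j = +-inverseˡ-unique _ _ (trans (+-comm _ _) (relation l j))

    -- If e·c = 0 then e·d = 0 (as B is independent), so e·(c,d) = 0 and e = 0.
    c-indep : LinIndep c
    c-indep e e·c≈0 = independent e (vanish-on-halves k k (lincomb e solutions)
      (λ i → trans (reflexive (lincomb-reindex e solutions (_↑ˡ k) i)) (e·c≈0 i))
      (λ i → trans (reflexive (lincomb-reindex e solutions (k ↑ʳ_) i)) (e·d≈0 i)))
      where
      e·d≈0 : ∀ i → lincomb e d i ≈ 0#
      e·d≈0 = indep B (lincomb e d) λ j → begin
        lincomb (lincomb e d) (basis B) j            ≈⟨ lincomb-compose e d (basis B) j ⟩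
        lincomb e (λ l → inBasis B (d l)) j          ≈⟨ lincomb-cong (λ _ → refl) (λ l → d·B≈-c·B₀ l j) ⟩
        lincomb e (λ l j′ → - inBasis B₀ (c l) j′) j ≈⟨ lincomb-negateᵇ e (λ l → inBasis B₀ (c l)) j ⟩
        - lincomb e (λ l → inBasis B₀ (c l)) j       ≈⟨ -‿cong (lincomb-compose e c (basis B₀) j) ⟨
        - lincomb (lincomb e c) (basis B₀) j         ≈⟨ -‿cong (lincomb-zeroᶜ (basis B₀) j e·c≈0) ⟩
        - 0#                                         ≈⟨ -0#≈0# ⟩
        0#                                           ∎

    residual : Subspace k m
    residual = record { basis = c ; indep = c-indep }

    -- v = e·c  ⇒  inBasis B₀ v = e·(c·B₀) = −e·(d·B) = (−e·d)·B ∈ B.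
    residual-in-B : ∀ v → InSpan v c → InSpan (inBasis B₀ v) (basis B)
    residual-in-B v (e , v≈e·c) = (λ i → - lincomb e d i) , λ j → begin
      inBasis B₀ v j                               ≈⟨ lincomb-cong v≈e·c (λ _ → refl) ⟩
      lincomb (lincomb e c) (basis B₀) j           ≈⟨ lincomb-compose e c (basis B₀) j ⟩
      lincomb e (λ l → inBasis B₀ (c l)) j         ≈⟨ lincomb-cong (λ _ → refl) (λ l → c·B₀≈-d·B l j) ⟩
      lincomb e (λ l j′ → - inBasis B (d l) j′) j  ≈⟨ lincomb-negateᵇ e (λ l → inBasis B (d l)) j ⟩
      - lincomb e (λ l → inBasis B (d l)) j        ≈⟨ -‿cong (lincomb-compose e d (basis B) j) ⟨
      - lincomb (lincomb e d) (basis B) j          ≈⟨ lincomb-negateᶜ (lincomb e d) (basis B) j ⟨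
      lincomb (λ i → - lincomb e d i) (basis B) j  ∎

-- Natural-number arithmetic is opened only from here on: inside LinearAlgebra the
-- symbols _+_ and _*_ denote the field operations.
open import Data.Nat using (_+_; _*_; _∸_; _^_; _≤_; _<_; s≤s; z≤n)
open import Data.Nat.Properties using (m+[n∸m]≡n; <⇒≤; +-identityʳ; ≤-reflexive)
open import Data.Nat.Primality using (Prime)
open import Data.List using (List; []; _∷_; length; map; lookup)
open import Data.List.Properties using (length-map)
open import Function.Definitions using (Injective)

mapIndex : ∀ {A B : Set} (φ : A → B) (xs : List A) → Fin (length (map φ xs)) → Fin (length xs)
mapIndex φ (x ∷ xs) zero    = zero
mapIndex φ (x ∷ xs) (suc i) = suc (mapIndex φ xs i)

lookup-map : ∀ {A B : Set} (φ : A → B) (xs : List A) i → lookup (map φ xs) i ≡ φ (lookup xs (mapIndex φ xs i))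
lookup-map φ (x ∷ xs) zero    = ≡.refl
lookup-map φ (x ∷ xs) (suc i) = lookup-map φ xs i

mapIndex-injective : ∀ {A B : Set} (φ : A → B) (xs : List A) → Injective _≡_ _≡_ (mapIndex φ xs)
mapIndex-injective φ (x ∷ xs) {zero}  {zero}  _ = ≡.refl
mapIndex-injective φ (x ∷ xs) {suc i} {suc j} e = ≡.cong suc (mapIndex-injective φ xs (Fin.suc-injective e))

module ResidualPacking {q : ℕ} (F : FiniteField q) where
  open Linear F
  open LinearAlgebra F

  emptyPacking : ∀ {n k t lam} → IsPacking n k t lam []
  emptyPacking T f _ _ with f zero
  ... | ()

  residuals : ∀ {n k m} → n + m ≡ k + k → Subspace n k → List (Subspace n k) → List (Subspace k m)
  residuals n+m≡2k B₀ = map (Residual.residual n+m≡2k B₀)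

  length-residuals : ∀ {n k m} (n+m≡2k : n + m ≡ k + k) (B₀ : Subspace n k) (rest : List (Subspace n k)) →
    length (residuals n+m≡2k B₀ rest) ≡ length rest
  length-residuals n+m≡2k B₀ = length-map (Residual.residual n+m≡2k B₀)

  -- If B₀ ∷ rest is a packing of multiplicity λ + 1, the residuals of rest form a packing of
  -- multiplicity λ: a t-subspace T in λ + 1 residuals embeds into B₀ and into the λ + 1
  -- corresponding blocks of rest, i.e. into λ + 2 blocks of B₀ ∷ rest.
  residualPacking : ∀ {n k m t lam} (n+m≡2k : n + m ≡ k + k) (B₀ : Subspace n k) (rest : List (Subspace n k)) →
    IsPacking n k t (suc lam) (B₀ ∷ rest) → IsPacking k m t lam (residuals n+m≡2k B₀ rest)
  residualPacking {n} {k} {m} {t} {lam} n+m≡2k B₀ rest packing T f f-injective T⊆residuals =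
    packing (embed B₀ T) g g-injective embed-⊆blocks
    where
    φ : Subspace n k → Subspace k m
    φ = Residual.residual n+m≡2k B₀

    g : Fin (suc (suc lam)) → Fin (length (B₀ ∷ rest))
    g zero    = zero
    g (suc j) = suc (mapIndex φ rest (f j))

    g-injective : Injective _≡_ _≡_ g
    g-injective {zero}  {zero}  _ = ≡.refl
    g-injective {suc i} {suc j} e = ≡.cong suc (f-injective (mapIndex-injective φ rest (Fin.suc-injective e)))

    embed-⊆blocks : ∀ j → embed B₀ T ⊆ₛ lookup (B₀ ∷ rest) (g j)
    embed-⊆blocks zero = embed-⊆ B₀ T
    embed-⊆blocks (suc j) i = Residual.residual-in-B n+m≡2k B₀ B (basis T i)
      (≡.subst (λ C → InSpan (basis T i) (basis C)) (lookup-map φ rest (f j)) (T⊆residuals j i))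
      where
      B : Subspace n k
      B = lookup rest (mapIndex φ rest (f j))

open ResidualPacking

n+[2k∸n]≡k+k : ∀ n k → n < 2 * k → n + (2 * k ∸ n) ≡ k + k
n+[2k∸n]≡k+k n k n<2k = ≡.trans (m+[n∸m]≡n (<⇒≤ n<2k)) (≡.cong (k +_) (+-identityʳ k))

proposition18 : (q : ℕ) → (∃ λ p → ∃ λ e → Prime p × q ≡ p ^ suc e) →
    (F : FiniteField q) → (n k t lam : ℕ) →
    1 ≤ n → 1 ≤ k → 1 ≤ t → 1 < lam → n < 2 * k → k ≤ n → t ≤ (2 * k) ∸ n →
    (P : List (Linear.Subspace F n k)) → Linear.IsPacking F n k t lam P →
    Σ (List (Linear.Subspace F k ((2 * k) ∸ n))) λ P′ →
      Linear.IsPacking F k ((2 * k) ∸ n) t (lam ∸ 1) P′ × length P ≤ 1 + length P′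
proposition18 q _ F n k t zero _ _ _ () _ _ _ _ _
proposition18 q _ F n k t (suc lam) _ _ _ _ _ _ _ [] _ = [] , emptyPacking F , z≤n
proposition18 q _ F n k t (suc lam) _ _ _ _ n<2k _ _ (B₀ ∷ rest) packing =
  residuals F n+m≡2k B₀ rest ,
  residualPacking F n+m≡2k B₀ rest packing ,
  s≤s (≤-reflexive (≡.sym (length-residuals F n+m≡2k B₀ rest)))
  where
  n+m≡2k : n + (2 * k ∸ n) ≡ k + k
  n+m≡2k = n+[2k∸n]≡k+k n k n<2k
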